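{- The upper irredundance number $\operatorname{IR}$ (with $Y$-sets the irredundant sets) and the upper zero forcing irredundance number $\operatorname{ZIR}$ (with $Y$-sets the $\operatorname{Z}$-irredundant sets) are robust $Y$-set parameters.
   Context: All graphs are finite, simple, undirected, with nonempty vertex set. For $T\subseteq V(G)$ and $x\in T$, a private neighbor of $x$ relative to $T$ is a vertex $w$ such that $x$ is the unique vertex of $T$ in the closed neighborhood $N[w]$; $T$ is irredundant (an Ir-set) if every $x\in T$ has a private neighbor relative to $T$; $\operatorname{IR}(G)$ is the maximum size of an Ir-set. A fort of $G$ is a nonempty $F\subseteq V(G)$ such that $|F\cap N(v)|\ne 1$ for every $v\in V(G)\setminus F$. For $x\in T$, a fort $F$ is a private fort of $x$ relative to $T$ if $T\cap F=\{x\}$; $T$ is $\operatorname{Z}$-irredundant (a ZIr-set) if every element of $T$ has a private fort relative to $T$; $\operatorname{ZIR}(G)$ is the maximum size of a ZIr-set. A vertex set property assigns to each graph a family of subsets of its vertex set (its $Y$-sets), invariant under isomorphism; it is cohesive if every graph has a $Y$-set. A robust $Y$-set parameter is a cohesive vertex set property, with parameter the maximum cardinality of a $Y$-set, satisfying: (Subset) subsets of $Y$-sets are $Y$-sets; (Singletons) if $G$ is connected of order at least two then every one-vertex subset is a $Y$-set; (Component consistency) if $G_1,\dots,G_k$ are the connected components of $G$, then $T$ is a $Y$-set of $G$ iff $T\cap V(G_i)$ is a $Y$-set of $G_i$ for all $i$. -}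

module Defs where

open import Data.Bool using (Bool; true; false)
import Data.Bool.Properties as BoolP
open import Data.List using (List; []; _∷_)
open import Data.List.Membership.Propositional using (_∈_)
open import Data.List.Relation.Unary.Any using (here; there)
open import Data.Product using (Σ; ∃; ∃-syntax; _×_; _,_; proj₁; proj₂)
open import Data.Empty using (⊥)
open import Relation.Nullary using (¬_; yes; no; does)
open import Relation.Binary.Definitions using (DecidableEquality)
open import Relation.Binary.PropositionalEquality
  using (_≡_; _≢_; refl; sym; trans; cong)
open import Function.Bundles using (Bijection; _⤖_)
open import Axiom.UniquenessOfIdentityProofs using (module Decidable⇒UIP)

-- Vertex set: an arbitrary type V with decidable equality and a list
-- containing every vertex (finiteness); adjacency is a Boolean relation
-- that is symmetric and irreflexive (simple, undirected, no loops).

record Graph : Set₁ where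
  field
    V          : Set
    _≟_        : DecidableEquality V
    adj        : V → V → Bool
    adj-sym    : ∀ u v → adj u v ≡ adj v u
    adj-irrefl : ∀ v → adj v v ≡ false
    vertices   : List V
    complete   : ∀ v → v ∈ vertices
    inhabitant : V

open Graph public

Subset : Graph → Set
Subset G = V G → Bool

_∈ₛ_ : {G : Graph} → V G → Subset G → Set
v ∈ₛ T = T v ≡ true

_⊆ₛ_ : {G : Graph} → Subset G → Subset G → Set
_⊆ₛ_ {G} S T = ∀ (v : V G) → S v ≡ true → T v ≡ true

singleton : (G : Graph) → V G → Subset G
singleton G x v = does (_≟_ G v x)

InN : (G : Graph) → V G → V G → Set
InN G v u = adj G v u ≡ true

InClosedN : (G : Graph) → V G → V G → Set
InClosedN G w u = (u ≡ w) ⊎' (adj G w u ≡ true)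
  where
  open import Data.Sum using () renaming (_⊎_ to _⊎'_)

PrivateNeighbor : (G : Graph) → Subset G → V G → V G → Set
PrivateNeighbor G T x w =
  (T x ≡ true) × InClosedN G w x ×
  (∀ y → T y ≡ true → InClosedN G w y → y ≡ x)

Irredundant : (G : Graph) → Subset G → Set
Irredundant G T = ∀ x → T x ≡ true → ∃[ w ] PrivateNeighbor G T x w

ExactlyOne : {A : Set} → (A → Set) → Set
ExactlyOne {A} P = Σ A λ u → P u × (∀ w → P w → w ≡ u)

IsFort : (G : Graph) → Subset G → Set
IsFort G F =
  (∃[ v ] F v ≡ true) ×
  (∀ v → F v ≡ false → ¬ ExactlyOne (λ u → F u ≡ true × InN G v u))

PrivateFort : (G : Graph) → Subset G → V G → Subset G → Set
PrivateFort G T x F =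
  IsFort G F × (T x ≡ true) × (F x ≡ true) ×
  (∀ y → T y ≡ true → F y ≡ true → y ≡ x)

ZIrredundant : (G : Graph) → Subset G → Set
ZIrredundant G T = ∀ x → T x ≡ true → Σ (Subset G) λ F → PrivateFort G T x F

record Iso (G H : Graph) : Set where
  field
    bij      : V G ⤖ V H
  open Bijection bij public using (to)
  field
    pres-adj : ∀ u v → adj H (to u) (to v) ≡ adj G u v

data Walk (G : Graph) : V G → V G → Set where
  here : ∀ {u} → Walk G u u
  step : ∀ {u w v} → adj G u w ≡ true → Walk G w v → Walk G u v

Connected : Graph → Set
Connected G = ∀ u v → Walk G u v

OrderAtLeastTwo : Graph → Set
OrderAtLeastTwo G = Σ (V G) λ u → Σ (V G) λ v → u ≢ v

IsComponent : (G : Graph) → Subset G → Set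
IsComponent G C =
  (∃[ v ] C v ≡ true) ×
  (∀ u v → C u ≡ true → C v ≡ true → Walk G u v) ×
  (∀ u v → C u ≡ true → adj G u v ≡ true → C v ≡ true)

module _ (G : Graph) (C : Subset G) where
  private
    W = Σ (V G) λ v → C v ≡ true
    module U = Decidable⇒UIP BoolP._≟_

  cons? : (v : V G) (b : Bool) → C v ≡ b → List W → List W
  cons? v true  eq ws = (v , eq) ∷ ws
  cons? v false eq ws = ws

  filt : List (V G) → List W
  filt [] = []
  filt (v ∷ vs) = cons? v (C v) refl (filt vs)

  cons?-here : (v : V G) (b : Bool) (eq : C v ≡ b) (ws : List W)
    (p : C v ≡ true) → (v , p) ∈ cons? v b eq ws
  cons?-here v true  eq ws p = here (cong (v ,_) (U.≡-irrelevant p eq))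
  cons?-here v false eq ws p with () ← trans (sym eq) p

  cons?-there : (v : V G) (b : Bool) (eq : C v ≡ b) (ws : List W)
    (w : W) → w ∈ ws → w ∈ cons? v b eq ws
  cons?-there v true  eq ws w m = there m
  cons?-there v false eq ws w m = m

  filt-complete : ∀ vs (w : W) → proj₁ w ∈ vs → w ∈ filt vs
  filt-complete (v ∷ vs) (.v , p) (here refl) =
    cons?-here v (C v) refl (filt vs) p
  filt-complete (v ∷ vs) w (there m) =
    cons?-there v (C v) refl (filt vs) w (filt-complete vs w m)

  decW : DecidableEquality W
  decW (u , p) (v , q) with _≟_ G u v
  ... | yes refl = yes (cong (u ,_) (U.≡-irrelevant p q))
  ... | no u≢v   = no λ e → u≢v (cong proj₁ e)

  component : IsComponent G C → Graph
  component ((v₀ , p₀) , _) = record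
    { V          = W
    ; _≟_        = decW
    ; adj        = λ a b → adj G (proj₁ a) (proj₁ b)
    ; adj-sym    = λ a b → adj-sym G (proj₁ a) (proj₁ b)
    ; adj-irrefl = λ a → adj-irrefl G (proj₁ a)
    ; vertices   = filt (vertices G)
    ; complete   = λ w → filt-complete (vertices G) w (complete G (proj₁ w))
    ; inhabitant = v₀ , p₀
    }

  restrict : (c : IsComponent G C) → Subset G → Subset (component c)
  restrict c T w = T (proj₁ w)

SetProperty : Set₁
SetProperty = (G : Graph) → Subset G → Set

IsoInvariant : SetProperty → Set₁
IsoInvariant Y = ∀ (G H : Graph) (φ : Iso G H) (T : Subset G) (T' : Subset H) →
  (∀ v → T' (Iso.to φ v) ≡ T v) →
  (Y G T → Y H T') × (Y H T' → Y G T)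

Cohesive : SetProperty → Set₁
Cohesive Y = ∀ (G : Graph) → Σ (Subset G) λ T → Y G T

SubsetClosed : SetProperty → Set₁
SubsetClosed Y = ∀ (G : Graph) (S T : Subset G) → Y G T → _⊆ₛ_ {G} S T → Y G S

Singletons : SetProperty → Set₁
Singletons Y = ∀ (G : Graph) → Connected G → OrderAtLeastTwo G →
  ∀ x → Y G (singleton G x)

ComponentConsistent : SetProperty → Set₁
ComponentConsistent Y = ∀ (G : Graph) (T : Subset G) →
  (Y G T → ∀ C (c : IsComponent G C) → Y (component G C c) (restrict G C c T)) ×
  ((∀ C (c : IsComponent G C) → Y (component G C c) (restrict G C c T)) → Y G T)

-- Y is a robust Y-set property (its parameter, the maximum size of a
-- Y-set, is then a robust Y-set parameter)
IsRobust : SetProperty → Set₁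
IsRobust Y = IsoInvariant Y × Cohesive Y × SubsetClosed Y ×
             Singletons Y × ComponentConsistent Y

-- Both properties are pointwise: T is a Y-set iff every x ∈ T has a witness
-- meeting T exactly in x, namely a vertex w with N[w] ∩ T = {x}, resp. a fort F
-- with F ∩ T = {x}. Such a property holds for ∅, passes to subsets, and holds for
-- {x} (witnessed by x itself, resp. by the fort V(G)); witnesses are carried
-- along isomorphisms; and since neither N[w] nor the neighbourhood of a vertex
-- leaves its component, witnesses restrict to the component of x and extend
-- (by ∅ outside it) back to G. The component of x is computed as the layer at
-- which breadth-first search from x stabilises.
module Submission where

open import Defs
open import Data.Bool using (Bool; true; false; _∨_; _∧_; if_then_else_)
open import Data.Bool.ListAction using (any)
import Data.Bool.Properties as Bool
open import Data.Empty using (⊥-elim)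
open import Data.List using (List; []; _∷_; length)
open import Data.List.Membership.Propositional using (_∈_; lose)
open import Data.List.Relation.Unary.Any using (here; there; satisfied)
open import Data.List.Relation.Unary.Any.Properties using (any⁺; any⁻)
open import Data.Nat using (ℕ; zero; suc; _≤_; _<_; _≤?_; z≤n; s≤s)
open import Data.Nat.Properties using (≤-trans; m≤n⇒m≤1+n; <⇒≱; ≰⇒>)
open import Data.Product using (Σ; ∃; ∃-syntax; _×_; _,_; proj₁; proj₂; map₂)
open import Data.Sum using (_⊎_; inj₁; inj₂)
open import Function using (_∘_; Equivalence; Inverse)
open import Function.Properties.Bijection using (Bijection⇒Inverse; sym-≡)
open import Relation.Nullary using (yes; no)
open import Relation.Binary.PropositionalEquality
  using (_≡_; _≢_; refl; sym; trans; cong; cong₂; subst)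
open import Axiom.UniquenessOfIdentityProofs using (module Decidable⇒UIP)

∨-true⁻ : ∀ a {b} → a ∨ b ≡ true → a ≡ true ⊎ b ≡ true
∨-true⁻ true  _ = inj₁ refl
∨-true⁻ false e = inj₂ e

true⇒≢false : ∀ {b} → b ≡ true → b ≢ false
true⇒≢false refl ()

module _ {A : Set} (p : A → Bool) where

  any-true⁻ : ∀ xs → any p xs ≡ true → ∃[ x ] p x ≡ true
  any-true⁻ xs = map₂ (Equivalence.to Bool.T-≡) ∘ satisfied ∘ any⁻ p xs ∘ Equivalence.from Bool.T-≡

  any-true⁺ : ∀ {x xs} → x ∈ xs → p x ≡ true → any p xs ≡ true
  any-true⁺ x∈xs px = Equivalence.to Bool.T-≡ (any⁺ p (lose x∈xs (Equivalence.from Bool.T-≡ px)))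

module _ {A : Set} where

  count : (A → Bool) → List A → ℕ
  count S []       = 0
  count S (v ∷ vs) = if S v then suc (count S vs) else count S vs

  count-≤-length : ∀ S (vs : List A) → count S vs ≤ length vs
  count-≤-length S []       = z≤n
  count-≤-length S (v ∷ vs) with S v
  ... | true  = s≤s (count-≤-length S vs)
  ... | false = m≤n⇒m≤1+n (count-≤-length S vs)

  module _ {S S' : A → Bool} (S⊆S' : ∀ v → S v ≡ true → S' v ≡ true) where

    count-mono : ∀ vs → count S vs ≤ count S' vs
    count-mono []       = z≤n
    count-mono (v ∷ vs) with S v in e | S' v in e'
    ... | true  | true  = s≤s (count-mono vs)
    ... | true  | false = ⊥-elim (true⇒≢false (S⊆S' v e) e')
    ... | false | true  = m≤n⇒m≤1+n (count-mono vs)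
    ... | false | false = count-mono vs

    count-mono-< : ∀ {u vs} → u ∈ vs → S u ≡ false → S' u ≡ true →
                   count S vs < count S' vs
    count-mono-< {vs = v ∷ vs} (here refl) Su Su' rewrite Su | Su' = s≤s (count-mono vs)
    count-mono-< {vs = v ∷ vs} (there u∈vs) Su Su' with S v in e | S' v in e'
    ... | true  | true  = s≤s (count-mono-< u∈vs Su Su')
    ... | true  | false = ⊥-elim (true⇒≢false (S⊆S' v e) e')
    ... | false | true  = m≤n⇒m≤1+n (count-mono-< u∈vs Su Su')
    ... | false | false = count-mono-< u∈vs Su Su'

  -- The count grows with every non-stable step, and it is bounded by the length.
  module _ (vs : List A) (complete : ∀ v → v ∈ vs)
           (S : ℕ → A → Bool) (S-mono : ∀ k v → S k v ≡ true → S (suc k) v ≡ true) where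

    private
      Stable : ℕ → Set
      Stable j = ∀ v → S (suc j) v ≡ true → S j v ≡ true

      not-growing⇒stable : ∀ k → count (S (suc k)) vs ≤ count (S k) vs → Stable k
      not-growing⇒stable k h v Sₖ₊₁v with S k v in e
      ... | true  = refl
      ... | false = ⊥-elim (<⇒≱ (count-mono-< (S-mono k) (complete v) e Sₖ₊₁v) h)

      stable-or-growing : ∀ k → ∃ Stable ⊎ k ≤ count (S k) vs
      stable-or-growing zero = inj₂ z≤n
      stable-or-growing (suc k) with stable-or-growing k
      ... | inj₁ stable = inj₁ stable
      ... | inj₂ k≤ with count (S (suc k)) vs ≤? count (S k) vs
      ...   | yes ≤ = inj₁ (k , not-growing⇒stable k ≤)
      ...   | no ≰  = inj₂ (≤-trans (s≤s k≤) (≰⇒> ≰))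

    increasing-chain-stabilises : ∃[ j ] (∀ v → S (suc j) v ≡ true → S j v ≡ true)
    increasing-chain-stabilises with stable-or-growing (suc (length vs))
    ... | inj₁ stable = stable
    ... | inj₂ h = ⊥-elim (<⇒≱ (s≤s (count-≤-length (S _) vs)) h)

walk-snoc : ∀ {G u w v} → Walk G u w → adj G w v ≡ true → Walk G u v
walk-snoc here       a = step a here
walk-snoc (step b p) a = step b (walk-snoc p a)

walk-reverse : ∀ {G u v} → Walk G u v → Walk G v u
walk-reverse here = here
walk-reverse {G} (step {u} {w} a p) = walk-snoc (walk-reverse p) (trans (adj-sym G w u) a)

walk-++ : ∀ {G u w v} → Walk G u w → Walk G w v → Walk G u v
walk-++ here       q = q
walk-++ (step a p) q = step a (walk-++ p q)

module _ (G : Graph) (x : V G) where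

  singleton-self : singleton G x x ≡ true
  singleton-self with _≟_ G x x
  ... | yes _  = refl
  ... | no x≢x = ⊥-elim (x≢x refl)

  singleton⁻ : ∀ {v} → singleton G x v ≡ true → v ≡ x
  singleton⁻ {v} e with _≟_ G v x
  ... | yes v≡x = v≡x
  singleton⁻ () | no _

module ComponentOf (G : Graph) (x : V G) where

  has-neighbour-in : Subset G → Subset G
  has-neighbour-in S v = any (λ u → S u ∧ adj G u v) (vertices G)

  layer : ℕ → Subset G
  layer zero      = singleton G x
  layer (suc k) v = layer k v ∨ has-neighbour-in (layer k) v

  layer-⊆-suc : ∀ k v → layer k v ≡ true → layer (suc k) v ≡ true
  layer-⊆-suc k v e = cong (_∨ has-neighbour-in (layer k) v) e

  x∈layer : ∀ k → layer k x ≡ true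
  x∈layer zero    = singleton-self G x
  x∈layer (suc k) = layer-⊆-suc k x (x∈layer k)

  walk-to-layer : ∀ k v → layer k v ≡ true → Walk G x v
  walk-to-layer zero v e with singleton⁻ G x e
  ... | refl = here
  walk-to-layer (suc k) v e with ∨-true⁻ (layer k v) e
  ... | inj₁ e' = walk-to-layer k v e'
  ... | inj₂ e' with any-true⁻ _ (vertices G) e'
  ... | u , e'' = walk-snoc (walk-to-layer k u (Bool.∧-conicalˡ _ _ e''))
                            (Bool.∧-conicalʳ _ _ e'')

  private
    stabilisation = increasing-chain-stabilises (vertices G) (complete G) layer layer-⊆-suc

  component-of : Subset G
  component-of = layer (proj₁ stabilisation)

  x∈component-of : component-of x ≡ true
  x∈component-of = x∈layer (proj₁ stabilisation)

  component-of-isComponent : IsComponent G component-of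
  component-of-isComponent =
    (x , x∈component-of) ,
    (λ u v Cu Cv → walk-++ (walk-reverse (walk-to-layer j u Cu)) (walk-to-layer j v Cv)) ,
    λ u v Cu a → proj₂ stabilisation v
      (trans (cong (layer j v ∨_) (any-true⁺ _ (complete G u) (cong₂ _∧_ Cu a)))
             (Bool.∨-zeroʳ (layer j v)))
    where j = proj₁ stabilisation

module InComponent (G : Graph) {C : Subset G} (c : IsComponent G C) where

  private
    Gᶜ = component G C c

  vertex-≡ : {a b : V Gᶜ} → proj₁ a ≡ proj₁ b → a ≡ b
  vertex-≡ {u , p} {.u , q} refl = cong (u ,_) (Decidable⇒UIP.≡-irrelevant Bool._≟_ p q)

  adj-closed : ∀ {u v} → C u ≡ true → adj G u v ≡ true → C v ≡ true
  adj-closed = proj₂ (proj₂ c) _ _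

  adj-closedˡ : ∀ {u v} → C v ≡ true → adj G u v ≡ true → C u ≡ true
  adj-closedˡ {u} {v} Cv a = adj-closed Cv (trans (adj-sym G v u) a)

  closedN-closed : ∀ {w y} → C w ≡ true → InClosedN G w y → C y ≡ true
  closedN-closed Cw (inj₁ refl) = Cw
  closedN-closed Cw (inj₂ a)    = adj-closed Cw a

  closedN-closedˡ : ∀ {w y} → C y ≡ true → InClosedN G w y → C w ≡ true
  closedN-closedˡ Cy (inj₁ refl) = Cy
  closedN-closedˡ Cy (inj₂ a)    = adj-closedˡ Cy a

  closedN-embed : ∀ {a b} → InClosedN Gᶜ a b → InClosedN G (proj₁ a) (proj₁ b)
  closedN-embed (inj₁ b≡a) = inj₁ (cong proj₁ b≡a)
  closedN-embed (inj₂ a)   = inj₂ a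

  closedN-restrict : ∀ {a b} → InClosedN G (proj₁ a) (proj₁ b) → InClosedN Gᶜ a b
  closedN-restrict (inj₁ b≡a) = inj₁ (vertex-≡ b≡a)
  closedN-restrict (inj₂ a)   = inj₂ a

  -- Extension by false. The case split on C v keeps its equation as an explicit
  -- argument so that the lemmas below can generalise over it.
  extend-by : Subset Gᶜ → ∀ v b → C v ≡ b → Bool
  extend-by F v true  Cv = F (v , Cv)
  extend-by F v false _  = false

  extend : Subset Gᶜ → Subset G
  extend F v = extend-by F v (C v) refl

  extend-⊆ : ∀ F {v} → extend F v ≡ true → C v ≡ true
  extend-⊆ F {v} = go (C v) refl
    where
    go : ∀ b (eq : C v ≡ b) → extend-by F v b eq ≡ true → C v ≡ true
    go true eq _ = eq

  extend-on : ∀ F {v} (Cv : C v ≡ true) → extend F v ≡ F (v , Cv)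
  extend-on F {v} Cv = go (C v) refl
    where
    go : ∀ b (eq : C v ≡ b) → extend-by F v b eq ≡ F (v , Cv)
    go true  eq = cong (λ p → F (v , p)) (Decidable⇒UIP.≡-irrelevant Bool._≟_ eq Cv)
    go false eq = ⊥-elim (true⇒≢false Cv eq)

  fort-restrict : ∀ {F x} → IsFort G F → C x ≡ true → F x ≡ true →
                  IsFort Gᶜ (restrict G C c F)
  fort-restrict {x = x} (_ , fort) Cx Fx =
    ((x , Cx) , Fx) ,
    λ { (v , Cv) Fv (u , (Fu , a) , unique) →
        fort v Fv (proj₁ u , (Fu , a) ,
          λ z (Fz , az) → cong proj₁ (unique (z , adj-closed Cv az) (Fz , az))) }

  fort-extend : ∀ {F} → IsFort Gᶜ F → IsFort G (extend F)
  fort-extend {F} (((v₀ , Cv₀) , Fv₀) , fort) =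
    (v₀ , trans (extend-on F Cv₀) Fv₀) ,
    λ v Fv (u , (Fu , a) , unique) →
      let Cu = extend-⊆ F Fu
          Cv = adj-closedˡ Cu a
      in fort (v , Cv) (trans (sym (extend-on F Cv)) Fv)
           ((u , Cu) , (trans (sym (extend-on F Cu)) Fu , a) ,
            λ w (Fw , aw) → vertex-≡ (unique (proj₁ w) (trans (extend-on F (proj₂ w)) Fw , aw)))

Iso-sym : ∀ {G H} → Iso G H → Iso H G
Iso-sym {G} {H} φ = record
  { bij      = sym-≡ (Iso.bij φ)
  ; pres-adj = λ u v → trans (sym (pres-adj (from u) (from v)))
                             (cong₂ (adj H) (to∘from u) (to∘from v))
  }
  where
  open Iso φ using (pres-adj)
  open Inverse (Bijection⇒Inverse (Iso.bij φ))
    using (from) renaming (strictlyInverseˡ to to∘from)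

module IsoProperties {G H : Graph} (φ : Iso G H) where

  open Iso φ public using (to; pres-adj)
  open Iso (Iso-sym φ) public using () renaming (to to from; pres-adj to pres-adj-from)
  open Inverse (Bijection⇒Inverse (Iso.bij φ)) public
    using () renaming (strictlyInverseˡ to to∘from; strictlyInverseʳ to from∘to)

  ∘from-≡ : ∀ {T : Subset G} {T' : Subset H} → (∀ v → T' (to v) ≡ T v) →
            ∀ y → T (from y) ≡ T' y
  ∘from-≡ {T} {T'} T'∘to≡T y = trans (sym (T'∘to≡T (from y))) (cong T' (to∘from y))

  adj-from : ∀ y w → adj H y (to w) ≡ adj G (from y) w
  adj-from y w = trans (cong (λ z → adj H z (to w)) (sym (to∘from y))) (pres-adj (from y) w)

  closedN-to : ∀ {a b} → InClosedN G a b → InClosedN H (to a) (to b)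
  closedN-to         (inj₁ refl) = inj₁ refl
  closedN-to {a} {b} (inj₂ e)    = inj₂ (trans (pres-adj a b) e)

  closedN-from : ∀ {a b} → InClosedN H (to a) b → InClosedN G a (from b)
  closedN-from {a}     (inj₁ refl) = inj₁ (from∘to a)
  closedN-from {a} {b} (inj₂ e)    =
    inj₂ (trans (sym (pres-adj a (from b))) (trans (cong (adj H (to a)) (to∘from b)) e))

  fort-to : ∀ {F} → IsFort G F → IsFort H (F ∘ from)
  fort-to {F} ((v₀ , Fv₀) , fort) =
    (to v₀ , trans (cong F (from∘to v₀)) Fv₀) ,
    λ v Fv (u , (Fu , a) , unique) →
      fort (from v) Fv (from u , (Fu , trans (pres-adj-from v u) a) ,
        λ w (Fw , aw) → trans (sym (from∘to w)) (cong from (unique (to w)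
          (trans (cong F (from∘to w)) Fw , trans (adj-from v w) aw))))

Pointwise : ((G : Graph) → Subset G → V G → Set) → SetProperty
Pointwise P G T = ∀ x → T x ≡ true → P G T x

record IsRobustWitness (P : (G : Graph) → Subset G → V G → Set) : Set₁ where
  field
    shrink         : ∀ G {S T} → _⊆ₛ_ {G} S T → ∀ x → S x ≡ true → P G T x → P G S x
    on-singleton   : ∀ G x → P G (singleton G x) x
    transport      : ∀ {G H} (φ : Iso G H) {T T'} → (∀ v → T' (Iso.to φ v) ≡ T v) →
                     ∀ x → P G T x → P H T' (Iso.to φ x)
    to-component   : ∀ G {C} (c : IsComponent G C) {T} x (Cx : C x ≡ true) →
                     P G T x → P (component G C c) (restrict G C c T) (x , Cx)
    from-component : ∀ G {C} (c : IsComponent G C) {T} x (Cx : C x ≡ true) →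
                     P (component G C c) (restrict G C c T) (x , Cx) → P G T x

Pointwise-robust : ∀ {P} → IsRobustWitness P → IsRobust (Pointwise P)
Pointwise-robust {P} w =
  isoInvariant ,
  (λ G → (λ _ → false) , λ _ ()) ,
  (λ G S T Y S⊆T x Sx → shrink G S⊆T x Sx (Y x (S⊆T x Sx))) ,
  (λ G _ _ x y y∈x → subst (P G (singleton G x)) (sym (singleton⁻ G x y∈x)) (on-singleton G x)) ,
  λ G T → (λ Y C c (x , Cx) Tx → to-component G c x Cx (Y x Tx)) ,
          (λ Y x Tx → let open ComponentOf G x in
             from-component G component-of-isComponent x x∈component-of
               (Y component-of component-of-isComponent (x , x∈component-of) Tx))
  where
  open IsRobustWitness w

  transport-all : ∀ {G H} (φ : Iso G H) {T T'} → (∀ v → T' (Iso.to φ v) ≡ T v) →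
                  Pointwise P G T → Pointwise P H T'
  transport-all φ {T} {T'} T'∘to≡T Y x' T'x' =
    subst (P _ T') (to∘from x')
      (transport φ T'∘to≡T (from x') (Y (from x') (trans (∘from-≡ T'∘to≡T x') T'x')))
    where open IsoProperties φ

  isoInvariant : IsoInvariant (Pointwise P)
  isoInvariant G H φ T T' T'∘to≡T =
    transport-all φ T'∘to≡T ,
    transport-all (Iso-sym φ) (IsoProperties.∘from-≡ φ T'∘to≡T)

open IsRobustWitness

privateNeighbor-robust : IsRobustWitness (λ G T x → ∃ (PrivateNeighbor G T x))
privateNeighbor-robust .shrink G S⊆T x Sx (w , _ , x∈N[w] , unique) =
  w , Sx , x∈N[w] , λ y Sy → unique y (S⊆T y Sy)
privateNeighbor-robust .on-singleton G x =
  x , singleton-self G x , inj₁ refl , λ y y∈x _ → singleton⁻ G x y∈x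
privateNeighbor-robust .transport φ T'∘to≡T x (w , Tx , x∈N[w] , unique) =
  to w , trans (T'∘to≡T x) Tx , closedN-to x∈N[w] ,
  λ y' T'y' y'∈N[to-w] → trans (sym (to∘from y'))
    (cong to (unique (from y') (trans (∘from-≡ T'∘to≡T y') T'y') (closedN-from y'∈N[to-w])))
  where open IsoProperties φ
privateNeighbor-robust .to-component G c x Cx (w , Tx , x∈N[w] , unique) =
  (w , closedN-closedˡ Cx x∈N[w]) , Tx , closedN-restrict x∈N[w] ,
  λ y Ty y∈N[w] → vertex-≡ (unique (proj₁ y) Ty (closedN-embed y∈N[w]))
  where open InComponent G c
privateNeighbor-robust .from-component G c x Cx ((w , Cw) , Tx , x∈N[w] , unique) =
  w , Tx , closedN-embed x∈N[w] ,
  λ y Ty y∈N[w] → cong proj₁ (unique (y , closedN-closed Cw y∈N[w]) Ty (closedN-restrict y∈N[w]))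
  where open InComponent G c

privateFort-robust : IsRobustWitness (λ G T x → Σ (Subset G) (PrivateFort G T x))
privateFort-robust .shrink G S⊆T x Sx (F , fort , _ , Fx , unique) =
  F , fort , Sx , Fx , λ y Sy → unique y (S⊆T y Sy)
privateFort-robust .on-singleton G x =
  (λ _ → true) , ((x , refl) , λ _ ()) , singleton-self G x , refl , λ y y∈x _ → singleton⁻ G x y∈x
privateFort-robust .transport φ T'∘to≡T x (F , fort , Tx , Fx , unique) =
  F ∘ from , fort-to fort , trans (T'∘to≡T x) Tx , trans (cong F (from∘to x)) Fx ,
  λ y' T'y' Fy' → trans (sym (to∘from y'))
    (cong to (unique (from y') (trans (∘from-≡ T'∘to≡T y') T'y') Fy'))
  where open IsoProperties φ
privateFort-robust .to-component G {C} c x Cx (F , fort , Tx , Fx , unique) =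
  restrict G C c F , fort-restrict fort Cx Fx , Tx , Fx ,
  λ y Ty Fy → vertex-≡ (unique (proj₁ y) Ty Fy)
  where open InComponent G c
privateFort-robust .from-component G c x Cx (F , fort , Tx , Fx , unique) =
  extend F , fort-extend fort , Tx , trans (extend-on F Cx) Fx ,
  λ y Ty Fy → let Cy = extend-⊆ F Fy in
    cong proj₁ (unique (y , Cy) Ty (trans (sym (extend-on F Cy)) Fy))
  where open InComponent G c

proposition8p23 : IsRobust Irredundant × IsRobust ZIrredundant
proposition8p23 = Pointwise-robust privateNeighbor-robust , Pointwise-robust privateFort-robust
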